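{- Let $F:\mathbb{N}^+\times\mathbb{N}^+\to\mathbb{N}^+$ be defined by $$F(m,n)=\frac{1}{4}\left[(m+n-1)^2-\big((m+n-1)\bmod 2\big)\right]+\min(m,n).$$ Let $S_O=\{(x,y)\in\mathbb{N}^+\times\mathbb{N}^+ : x\ge y\}$. Then the restriction of $F$ to $S_O$ is a bijection from $S_O$ onto $\mathbb{N}^+$.
   Context: $\mathbb{N}^+$ denotes the set of positive integers. For an integer $k$, $k\bmod 2$ denotes the least non-negative residue of $k$ modulo $2$. -}

module Defs where

open import Data.Nat using (ℕ; _+_; _*_; _∸_; _≤_; _⊓_)
open import Data.Nat.DivMod using (_/_; _%_)
open import Data.Product using (_×_)

-- F(m,n) = ((m+n-1)^2 - ((m+n-1) mod 2)) / 4 + min(m,n).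
-- The numerator is always divisible by 4, so floor division is exact.
F : ℕ → ℕ → ℕ
F m n = ((s * s ∸ (s % 2)) / 4) + (m ⊓ n)
  where s = m + n ∸ 1

InSO : ℕ → ℕ → Set
InSO x y = (1 ≤ x) × (1 ≤ y) × (y ≤ x)

-- Cut S_O along the anti-diagonals x + y = s + 1. The s-th one meets S_O in the points with
-- 1 ≤ y ≤ ⌈s/2⌉, and ⌊s²/4⌋ is exactly the number of points on the earlier anti-diagonals
-- (since ⌈s/2⌉ + ⌈(s+1)/2⌉ = s + 1 and (s+2)² = s² + 4(s+1)). So on S_O, F numbers the points
-- anti-diagonal by anti-diagonal, y counting within each one, and hits every positive integer once.
module Submission where

open import Defs
open import Data.Nat
  using (ℕ; zero; suc; _+_; _*_; _∸_; _≤_; _<_; z≤n; s≤s; _<?_; ⌊_/2⌋; ⌈_/2⌉)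
open import Data.Nat.DivMod using (_/_; _%_; m*n/n≡m)
open import Data.Nat.Properties
open import Data.Nat.Solver using (module +-*-Solver)
open import Data.Product using (_×_; ∃-syntax; _,_; proj₂)
open import Data.Sum using (inj₁; inj₂)
open import Data.Empty using (⊥-elim)
open import Relation.Nullary using (yes; no)
open import Relation.Binary using (tri<; tri≈; tri>)
open import Relation.Binary.PropositionalEquality
  using (_≡_; refl; sym; trans; cong; cong₂; subst; module ≡-Reasoning)

module Blocks (size : ℕ → ℕ) where

  offset : ℕ → ℕ
  offset zero    = 0
  offset (suc s) = offset s + size s

  Cell : ℕ → ℕ → Set
  Cell s j = 1 ≤ j × j ≤ size s

  InBlock : ℕ → ℕ → Set
  InBlock s k = offset s < k × k ≤ offset (suc s)

  offset-suc-mono : ∀ {s t} → s < t → offset (suc s) ≤ offset t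
  offset-suc-mono {s} {suc t} (s≤s s≤t) with m≤n⇒m<n∨m≡n s≤t
  ... | inj₁ s<t = ≤-trans (offset-suc-mono s<t) (m≤m+n (offset t) (size t))
  ... | inj₂ refl = ≤-refl

  InBlock-ordered : ∀ {s t k l} → s < t → InBlock s k → InBlock t l → k < l
  InBlock-ordered s<t (_ , k≤) (<l , _) = ≤-<-trans (≤-trans k≤ (offset-suc-mono s<t)) <l

  InBlock-unique : ∀ {s t k} → InBlock s k → InBlock t k → s ≡ t
  InBlock-unique {s} {t} {k} inS inT with <-cmp s t
  ... | tri< s<t _ _ = ⊥-elim (n≮n k (InBlock-ordered s<t inS inT))
  ... | tri≈ _ s≡t _ = s≡t
  ... | tri> _ _ t<s = ⊥-elim (n≮n k (InBlock-ordered t<s inT inS))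

  Cell⇒InBlock : ∀ {s j} → Cell s j → InBlock s (offset s + j)
  Cell⇒InBlock {s} (1≤j , j≤size) = m<m+n (offset s) 1≤j , +-monoʳ-≤ (offset s) j≤size

  offset-injective : ∀ {s j t i} → Cell s j → Cell t i → offset s + j ≡ offset t + i →
                     s ≡ t × j ≡ i
  offset-injective {s} {j} {t} {i} cell cell′ eq = s≡t , +-cancelˡ-≡ (offset s) j i eq′
    where
    s≡t : s ≡ t
    s≡t = InBlock-unique (Cell⇒InBlock cell) (subst (InBlock t) (sym eq) (Cell⇒InBlock cell′))
    eq′ : offset s + j ≡ offset s + i
    eq′ = trans eq (cong (λ r → offset r + i) (sym s≡t))

  InBlock-exists : ∀ s {k} → 1 ≤ k → k ≤ offset s → ∃[ t ] InBlock t k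
  InBlock-exists zero    1≤k k≤0 = ⊥-elim (<⇒≱ 1≤k k≤0)
  InBlock-exists (suc s) {k} 1≤k k≤ with offset s <? k
  ... | yes <k = s , <k , k≤
  ... | no ≮k = InBlock-exists s 1≤k (≮⇒≥ ≮k)

  offset-surjective : ∀ s {k} → 1 ≤ k → k ≤ offset s →
                      ∃[ t ] ∃[ j ] (Cell t j × offset t + j ≡ k)
  offset-surjective s {k} 1≤k k≤ with InBlock-exists s 1≤k k≤
  ... | t , <k , k≤′ = t , k ∸ offset t , cell , m+[n∸m]≡n (<⇒≤ <k)
    where
    cell : Cell t (k ∸ offset t)
    cell = m<n⇒0<n∸m <k
         , subst (k ∸ offset t ≤_) (m+n∸m≡n (offset t) (size t)) (∸-monoˡ-≤ (offset t) k≤′)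

⌊n/2⌋+⌊n/2⌋≤n : ∀ n → ⌊ n /2⌋ + ⌊ n /2⌋ ≤ n
⌊n/2⌋+⌊n/2⌋≤n n =
  subst (⌊ n /2⌋ + ⌊ n /2⌋ ≤_) (⌊n/2⌋+⌈n/2⌉≡n n) (+-monoʳ-≤ ⌊ n /2⌋ (⌊n/2⌋≤⌈n/2⌉ n))

m≤n⇒m≤⌊n+m/2⌋ : ∀ {m n} → m ≤ n → m ≤ ⌊ n + m /2⌋
m≤n⇒m≤⌊n+m/2⌋ {m} {n} m≤n =
  subst (_≤ ⌊ n + m /2⌋) (sym (n≡⌊n+n/2⌋ m)) (⌊n/2⌋-mono (+-monoˡ-≤ m m≤n))

m≤⌊n+m/2⌋⇒m≤n : ∀ {m n} → m ≤ ⌊ n + m /2⌋ → m ≤ n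
m≤⌊n+m/2⌋⇒m≤n {m} {n} m≤ =
  +-cancelʳ-≤ m m n (≤-trans (+-mono-≤ m≤ m≤) (⌊n/2⌋+⌊n/2⌋≤n (n + m)))

open Blocks ⌈_/2⌉

offset*4+parity≡square : ∀ s → offset s * 4 + s % 2 ≡ s * s
offset*4+parity≡square 0 = refl
offset*4+parity≡square 1 = refl
offset*4+parity≡square (suc (suc s)) = begin
  (offset s + ⌈ s /2⌉ + ⌈ suc s /2⌉) * 4 + s % 2
    ≡⟨ cong (λ t → t * 4 + s % 2)
            (trans (+-assoc (offset s) _ _) (cong (offset s +_) (⌊n/2⌋+⌈n/2⌉≡n (suc s)))) ⟩
  (offset s + suc s) * 4 + s % 2
    ≡⟨ solve 3 (λ o s r → (o :+ (con 1 :+ s)) :* con 4 :+ r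
                          := (o :* con 4 :+ r) :+ con 4 :* (con 1 :+ s))
             refl (offset s) s (s % 2) ⟩
  (offset s * 4 + s % 2) + 4 * suc s
    ≡⟨ cong (_+ 4 * suc s) (offset*4+parity≡square s) ⟩
  s * s + 4 * suc s
    ≡⟨ solve 1 (λ s → s :* s :+ con 4 :* (con 1 :+ s) := (con 2 :+ s) :* (con 2 :+ s))
             refl s ⟩
  suc (suc s) * suc (suc s) ∎
  where open ≡-Reasoning; open +-*-Solver

offset≡quarter-square : ∀ s → (s * s ∸ s % 2) / 4 ≡ offset s
offset≡quarter-square s = begin
  (s * s ∸ s % 2) / 4
    ≡⟨ cong (λ n → (n ∸ s % 2) / 4) (sym (offset*4+parity≡square s)) ⟩
  (offset s * 4 + s % 2 ∸ s % 2) / 4  ≡⟨ cong (_/ 4) (m+n∸n≡m (offset s * 4) (s % 2)) ⟩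
  offset s * 4 / 4                    ≡⟨ m*n/n≡m (offset s) 4 ⟩
  offset s                            ∎
  where open ≡-Reasoning

n≤offset[1+n] : ∀ n → n ≤ offset (suc n)
n≤offset[1+n] zero    = z≤n
n≤offset[1+n] (suc n) =
  subst (_≤ offset (suc (suc n))) (+-comm n 1) (+-mono-≤ (n≤offset[1+n] n) (s≤s z≤n))

InSO⇒Cell : ∀ {a y} → InSO (suc a) y → Cell (a + y) y
InSO⇒Cell (_ , 1≤y , y≤x) = 1≤y , m≤n⇒m≤⌊n+m/2⌋ y≤x

Cell⇒InSO : ∀ {a y} → Cell (a + y) y → InSO (suc a) y
Cell⇒InSO (1≤y , y≤) = s≤s z≤n , 1≤y , m≤⌊n+m/2⌋⇒m≤n y≤

F-on-diagonal : ∀ {a y} → y ≤ suc a → F (suc a) y ≡ offset (a + y) + y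
F-on-diagonal {a} y≤x = cong₂ _+_ (offset≡quarter-square (a + _)) (m≥n⇒m⊓n≡n y≤x)

Cell⇒F-preimage : ∀ {s y} → Cell s y →
                  InSO (suc (s ∸ y)) y × F (suc (s ∸ y)) y ≡ offset s + y
Cell⇒F-preimage {s} {y} cell@(_ , y≤⌈s/2⌉) =
  so , trans (F-on-diagonal (proj₂ (proj₂ so))) (cong (λ t → offset t + y) s∸y+y≡s)
  where
  s∸y+y≡s : s ∸ y + y ≡ s
  s∸y+y≡s = m∸n+n≡m (≤-trans y≤⌈s/2⌉ (⌈n/2⌉≤n s))
  so : InSO (suc (s ∸ y)) y
  so = Cell⇒InSO (subst (λ t → Cell t y) (sym s∸y+y≡s) cell)

theorem3 : (∀ x y → InSO x y → 1 ≤ F x y)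
    × (∀ x y x′ y′ → InSO x y → InSO x′ y′ → F x y ≡ F x′ y′ → (x ≡ x′ × y ≡ y′))
    × (∀ k → 1 ≤ k → ∃[ x ] ∃[ y ] (InSO x y × F x y ≡ k))
theorem3 = positive , injective , surjective
  where
  positive : ∀ x y → InSO x y → 1 ≤ F x y
  positive (suc a) y (_ , 1≤y , y≤x) rewrite F-on-diagonal y≤x = ≤-trans 1≤y (m≤n+m y _)

  injective : ∀ x y x′ y′ → InSO x y → InSO x′ y′ → F x y ≡ F x′ y′ → (x ≡ x′ × y ≡ y′)
  injective (suc a) y (suc a′) y′ so@(_ , _ , y≤x) so′@(_ , _ , y′≤x′) eq
    with offset-injective (InSO⇒Cell so) (InSO⇒Cell so′)
           (trans (sym (F-on-diagonal y≤x)) (trans eq (F-on-diagonal y′≤x′)))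
  ... | a+y≡a′+y , refl = cong suc (+-cancelʳ-≡ y a a′ a+y≡a′+y) , refl

  surjective : ∀ k → 1 ≤ k → ∃[ x ] ∃[ y ] (InSO x y × F x y ≡ k)
  surjective k 1≤k with offset-surjective (suc k) 1≤k (n≤offset[1+n] k)
  ... | s , y , cell , offset+y≡k with Cell⇒F-preimage cell
  ...   | so , F≡offset+y = suc (s ∸ y) , y , so , trans F≡offset+y offset+y≡k
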